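{- Let $c$, $d$, $k$ be positive integers with $k\le c\le d$. For every integer $\ell\in[1,c+d-k]$ define \[F(\ell)=\sum_{r=0}^{k-1}(-1)^r\binom{c-1-r}{k-1-r}\binom{c+d-k}{r}\binom{k-1-r}{k+\ell-c-1}\] and \[G(\ell)=\sum_{r=0}^{k-1}(-1)^r\binom{d-1-r}{k-1-r}\binom{c+d-k}{r}\binom{k-1-r}{c-\ell}.\] Then for every integer $\ell\in[1,c+d-k]$, \[F(\ell)=(-1)^{\ell-c}\binom{\ell-1}{c-k}\binom{c+d-k-\ell}{d-k},\qquad G(\ell)=(-1)^{\ell+k-c-1}\binom{\ell-1}{c-k}\binom{c+d-k-\ell}{d-k},\] and hence $F(\ell)+(-1)^kG(\ell)=0$.
   Context: Binomial coefficients follow the convention: for an integer $n$ and an integer $m\ge 0$, $\binom{n}{m}=n(n-1)\cdots(n-m+1)/m!$, and $\binom{n}{m}=0$ for integers $m<0$. -}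

module Defs where

open import Data.Nat as ℕ using (ℕ; zero; suc)
open import Data.Nat.Properties using (_!≢0)
open import Data.Integer as ℤ using (ℤ; +_; -[1+_]; _-_; _*_; _^_)
open import Data.Integer.DivMod using (_/ℕ_)

falling : ℤ → ℕ → ℤ
falling n zero    = + 1
falling n (suc m) = falling n m * (n - + m)

-- binomial coefficient, following the paper's convention:
-- for integer n and integer m ≥ 0:  n(n-1)...(n-m+1)/m!  (an exact division),
-- and 0 for m < 0.
binom : ℤ → ℤ → ℤ
binom n (+ m)    = (falling n m /ℕ (m ℕ.!)) {{m !≢0}}
binom n -[1+ _ ] = + 0

-- (-1)^e for an integer exponent e (well defined since (-1)^(-1) = -1)
sgn : ℤ → ℤ
sgn e = (ℤ.- + 1) ^ ℤ.∣ e ∣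

sumBelow : ℕ → (ℕ → ℤ) → ℤ
sumBelow zero    f = + 0
sumBelow (suc K) f = sumBelow K f ℤ.+ f K

module _ (c d k : ℕ) where
  private
    C D K : ℤ
    C = + c
    D = + d
    K = + k

  F : ℤ → ℤ
  F ℓ = sumBelow k λ r → let R = + r in
    sgn R * binom (C - + 1 - R) (K - + 1 - R) * binom (C ℤ.+ D - K) R
      * binom (K - + 1 - R) (K ℤ.+ ℓ - C - + 1)

  G : ℤ → ℤ
  G ℓ = sumBelow k λ r → let R = + r in
    sgn R * binom (D - + 1 - R) (K - + 1 - R) * binom (C ℤ.+ D - K) R
      * binom (K - + 1 - R) (C - ℓ)

{-# OPTIONS --safe #-}
-- Write a = c - k, m = ℓ - 1 - a, N = c + d - k and j = k - 1 - r.  The r-th summand of F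
-- is (-1)^r C(N,r) · C(a+j,j) C(j,m), so F is the coefficient of x^(k-1) in the product of
-- (1 - x)^N with Σ_j C(a+j,j) C(j,m) x^j.  By trinomial revision this series equals
-- C(a+m,m) x^m (1 - x)^(-(a+m+1)), hence F = C(a+m,m) [x^(k-1-m)] (1 - x)^(N-a-m-1), which is
-- the closed form; when m lies outside [0, k-1] both sides vanish.  G is F with c and d
-- exchanged and ℓ reflected to c + d - k + 1 - ℓ, and the two closed forms differ by the
-- sign (-1)^(k-1).
module Submission where

open import Data.Bool.Base using (true)
open import Data.Integer as ℤ using (ℤ; +_; -[1+_]; _+_; _-_; _*_; -_) renaming (_≤_ to _≤ℤ_)
open import Data.Integer.DivMod using (_/ℕ_)
import Data.Integer.Properties as ℤₚ
open import Data.Integer.Tactic.RingSolver using (solve-∀)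
open import Data.Nat as ℕ using (ℕ; zero; suc; _≤_; _<_; z≤n; s≤s; _!; _∸_)
open import Data.Nat.Combinatorics
  using (_C_; _P_; nCk+nC[k+1]≡[n+1]C[k+1]; nCn≡1; nCk≡nC[n∸k]; nCk≡nPk/k!; k>n⇒nCk≡0;
         nCk≡n!/k![n-k]!; k![n∸k]!∣n!)
open import Data.Nat.Combinatorics.Base using (_P′_)
open import Data.Nat.DivMod using (_/_; 0/n≡0; m/n*n≡m)
import Data.Nat.Properties as ℕₚ
open import Data.Nat.Tactic.RingSolver renaming (solve-∀ to ℕ-solve-∀)
open import Data.Product using (_×_; _,_)
open import Data.Sum using (inj₁; inj₂)
open import Defs
open import Function.Base using (_∘_)
open import Relation.Binary.PropositionalEquality
open ≡-Reasoning

-- Binomial coefficients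

nP′k≡0 : ∀ {n k} → n < k → n P′ k ≡ 0
nP′k≡0 {n} (s≤s {n = k} n≤k) = cong (ℕ._* (n P′ k)) (ℕₚ.m≤n⇒m∸n≡0 n≤k)

nPk≡nP′k : ∀ {n k} → k ≤ n → n P k ≡ n P′ k
nPk≡nP′k {n} {k} k≤n with k ℕ.≤ᵇ n | ℕₚ.≤⇒≤ᵇ k≤n
... | true | _ = refl

-- For k > n both sides vanish: n P′ k already contains the factor n ∸ n = 0.
+nP′k*[n-k] : ∀ n k → + (n P′ k) * (+ n - + k) ≡ + (n P′ suc k)
+nP′k*[n-k] n k with ℕₚ.≤-<-connex k n
... | inj₁ k≤n = begin
  + (n P′ k) * (+ n - + k)   ≡⟨ cong (+ (n P′ k) *_) (trans (ℤₚ.m-n≡m⊖n n k) (ℤₚ.⊖-≥ k≤n)) ⟩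
  + (n P′ k) * + (n ∸ k)     ≡⟨ ℤₚ.pos-* (n P′ k) (n ∸ k) ⟨
  + ((n P′ k) ℕ.* (n ∸ k))   ≡⟨ cong +_ (ℕₚ.*-comm (n P′ k) (n ∸ k)) ⟩
  + (n P′ suc k)             ∎
... | inj₂ n<k rewrite nP′k≡0 n<k = cong +_ (sym (ℕₚ.*-zeroʳ (n ∸ k)))

falling≡P′ : ∀ n k → falling (+ n) k ≡ + (n P′ k)
falling≡P′ n zero    = refl
falling≡P′ n (suc k) = trans (cong (_* (+ n - + k)) (falling≡P′ n k)) (+nP′k*[n-k] n k)

binom-+ : ∀ n k → binom (+ n) (+ k) ≡ + (n C k)
binom-+ n k = trans (cong (λ x → (x /ℕ k !) {{k ℕₚ.!≢0}}) (falling≡P′ n k)) (cong +_ nP′k/k!≡nCk)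
  where
  instance _ = k ℕₚ.!≢0
  nP′k/k!≡nCk : (n P′ k) / k ! ≡ n C k
  nP′k/k!≡nCk with ℕₚ.≤-<-connex k n
  ... | inj₁ k≤n = trans (cong (_/ k !) (sym (nPk≡nP′k k≤n))) (sym (nCk≡nPk/k! k≤n))
  ... | inj₂ n<k = trans (cong (_/ k !) (nP′k≡0 n<k)) (trans (0/n≡0 (k !)) (sym (k>n⇒nCk≡0 n<k)))

nCk*[k!*[n∸k]!]≡n! : ∀ {n k} → k ≤ n → (n C k) ℕ.* (k ! ℕ.* (n ∸ k) !) ≡ n !
nCk*[k!*[n∸k]!]≡n! {n} {k} k≤n =
  trans (cong (ℕ._* (k ! ℕ.* (n ∸ k) !)) (nCk≡n!/k![n-k]! k≤n)) (m/n*n≡m (k![n∸k]!∣n! k≤n))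
  where instance _ = k ℕₚ.!* (n ∸ k) !≢0

[m+n]Cn*[n!*m!]≡[m+n]! : ∀ m n → ((m ℕ.+ n) C n) ℕ.* (n ! ℕ.* m !) ≡ (m ℕ.+ n) !
[m+n]Cn*[n!*m!]≡[m+n]! m n = subst (λ x → ((m ℕ.+ n) C n) ℕ.* (n ! ℕ.* x !) ≡ (m ℕ.+ n) !)
  (ℕₚ.m+n∸n≡m m n) (nCk*[k!*[n∸k]!]≡n! (ℕₚ.m≤n+m n m))

trinomial-revision : ∀ a m i →
  ((a ℕ.+ (m ℕ.+ i)) C (m ℕ.+ i)) ℕ.* ((m ℕ.+ i) C m) ≡ ((a ℕ.+ m) C m) ℕ.* ((a ℕ.+ m ℕ.+ i) C i)
trinomial-revision a m i = ℕₚ.*-cancelʳ-≡ _ _ (a ! ℕ.* (m ! ℕ.* i !)) {{nonZero}} (begin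
  X ℕ.* Y ℕ.* (a ! ℕ.* (m ! ℕ.* i !))        ≡⟨ regroupˡ X Y (a !) (m !) (i !) ⟩
  X ℕ.* (Y ℕ.* (m ! ℕ.* i !) ℕ.* a !)        ≡⟨ cong (λ y → X ℕ.* (y ℕ.* a !)) Y-factorial ⟩
  X ℕ.* ((m ℕ.+ i) ! ℕ.* a !)                ≡⟨ [m+n]Cn*[n!*m!]≡[m+n]! a (m ℕ.+ i) ⟩
  (a ℕ.+ (m ℕ.+ i)) !                       ≡⟨ cong _! (ℕₚ.+-assoc a m i) ⟨
  (a ℕ.+ m ℕ.+ i) !                         ≡⟨ [m+n]Cn*[n!*m!]≡[m+n]! (a ℕ.+ m) i ⟨
  Z ℕ.* (i ! ℕ.* (a ℕ.+ m) !)               ≡⟨ cong (λ w → Z ℕ.* (i ! ℕ.* w)) ([m+n]Cn*[n!*m!]≡[m+n]! a m) ⟨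
  Z ℕ.* (i ! ℕ.* (W ℕ.* (m ! ℕ.* a !)))      ≡⟨ regroupʳ Z W (a !) (m !) (i !) ⟩
  W ℕ.* Z ℕ.* (a ! ℕ.* (m ! ℕ.* i !))        ∎)
  where
  X = (a ℕ.+ (m ℕ.+ i)) C (m ℕ.+ i)
  Y = (m ℕ.+ i) C m
  Z = (a ℕ.+ m ℕ.+ i) C i
  W = (a ℕ.+ m) C m
  nonZero = ℕₚ.m*n≢0 (a !) (m ! ℕ.* i !) {{a ℕₚ.!≢0}} {{m ℕₚ.!* i !≢0}}
  Y-factorial : Y ℕ.* (m ! ℕ.* i !) ≡ (m ℕ.+ i) !
  Y-factorial =
    subst (λ n → (n C m) ℕ.* (m ! ℕ.* i !) ≡ n !) (ℕₚ.+-comm i m) ([m+n]Cn*[n!*m!]≡[m+n]! i m)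
  regroupˡ : ∀ x y a m i → x ℕ.* y ℕ.* (a ℕ.* (m ℕ.* i)) ≡ x ℕ.* (y ℕ.* (m ℕ.* i) ℕ.* a)
  regroupˡ = ℕ-solve-∀
  regroupʳ : ∀ z w a m i → z ℕ.* (i ℕ.* (w ℕ.* (m ℕ.* a))) ≡ w ℕ.* z ℕ.* (a ℕ.* (m ℕ.* i))
  regroupʳ = ℕ-solve-∀

[m+n]Cm≡[m+n]Cn : ∀ m n → (m ℕ.+ n) C m ≡ (m ℕ.+ n) C n
[m+n]Cm≡[m+n]Cn m n = trans (nCk≡nC[n∸k] (ℕₚ.m≤m+n m n)) (cong ((m ℕ.+ n) C_) (ℕₚ.m+n∸m≡n m n))

-- Signs

sgn-neg : ∀ x → sgn (- x) ≡ sgn x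
sgn-neg x = cong ((- + 1) ℤ.^_) (ℤₚ.∣-i∣≡∣i∣ x)

sgn-suc : ∀ x → sgn (x + + 1) ≡ - sgn x
sgn-suc (+ n)        = trans (cong (λ m → sgn (+ m)) (ℕₚ.+-comm n 1)) (ℤₚ.-1*i≡-i (sgn (+ n)))
sgn-suc -[1+ zero ]  = refl
sgn-suc -[1+ suc n ] =
  sym (trans (cong -_ (ℤₚ.-1*i≡-i (sgn (+ suc n)))) (ℤₚ.neg-involutive (sgn (+ suc n))))

sgn-+ : ∀ x n → sgn (x + + n) ≡ sgn x * sgn (+ n)
sgn-+ x zero    = trans (cong sgn (ℤₚ.+-identityʳ x)) (sym (ℤₚ.*-identityʳ (sgn x)))
sgn-+ x (suc n) = begin
  sgn (x + + suc n)        ≡⟨ cong sgn (reassoc x (+ n)) ⟩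
  sgn (x + + n + + 1)      ≡⟨ sgn-suc (x + + n) ⟩
  - sgn (x + + n)          ≡⟨ cong -_ (sgn-+ x n) ⟩
  - (sgn x * sgn (+ n))    ≡⟨ flip-sign (sgn x) (sgn (+ n)) ⟩
  sgn x * sgn (+ suc n)    ∎
  where
  reassoc : ∀ x m → x + (+ 1 + m) ≡ x + m + + 1
  reassoc = solve-∀
  flip-sign : ∀ σ τ → - (σ * τ) ≡ σ * (- + 1 * τ)
  flip-sign = solve-∀

sgn[n]*sgn[n]≡1 : ∀ n → sgn (+ n) * sgn (+ n) ≡ + 1
sgn[n]*sgn[n]≡1 zero    = refl
sgn[n]*sgn[n]≡1 (suc n) = trans (square (sgn (+ n))) (sgn[n]*sgn[n]≡1 n)
  where square : ∀ σ → (- + 1 * σ) * (- + 1 * σ) ≡ σ * σ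
        square = solve-∀

-- Cauchy products of integer sequences

Seq : Set
Seq = ℕ → ℤ

tail : Seq → Seq
tail u i = u (suc i)

-- As operations on generating series, shift multiplies by x and Δ by 1 - x.
shift : Seq → Seq
shift u zero    = + 0
shift u (suc j) = u j

Δ : Seq → Seq
Δ u j = u j - shift u j

δ : Seq
δ zero    = + 1
δ (suc _) = + 0

infixl 7 _⋆_

_⋆_ : Seq → Seq → Seq
(u ⋆ v) zero    = u 0 * v 0
(u ⋆ v) (suc s) = u 0 * v (suc s) + (tail u ⋆ v) s

⋆-cong : ∀ {u u′ v v′} → (∀ i → u i ≡ u′ i) → (∀ j → v j ≡ v′ j) → ∀ s → (u ⋆ v) s ≡ (u′ ⋆ v′) s
⋆-cong u≗u′ v≗v′ zero    = cong₂ _*_ (u≗u′ 0) (v≗v′ 0)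
⋆-cong u≗u′ v≗v′ (suc s) =
  cong₂ _+_ (cong₂ _*_ (u≗u′ 0) (v≗v′ (suc s))) (⋆-cong (λ i → u≗u′ (suc i)) v≗v′ s)

⋆-distribˡ-− : ∀ u v w s → (u ⋆ (λ j → v j - w j)) s ≡ (u ⋆ v) s - (u ⋆ w) s
⋆-distribˡ-− u v w zero    = distrib (u 0) (v 0) (w 0)
  where distrib : ∀ a b c → a * (b - c) ≡ a * b - a * c
        distrib = solve-∀
⋆-distribˡ-− u v w (suc s) =
  trans (cong (λ x → u 0 * (v (suc s) - w (suc s)) + x) (⋆-distribˡ-− (tail u) v w s))
        (regroup (u 0) (v (suc s)) (w (suc s)) _ _)
  where regroup : ∀ a b c x y → a * (b - c) + (x - y) ≡ (a * b + x) - (a * c + y)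
        regroup = solve-∀

⋆-distribʳ-− : ∀ u w v s → ((λ i → u i - w i) ⋆ v) s ≡ (u ⋆ v) s - (w ⋆ v) s
⋆-distribʳ-− u w v zero    = distrib (u 0) (w 0) (v 0)
  where distrib : ∀ a b c → (a - b) * c ≡ a * c - b * c
        distrib = solve-∀
⋆-distribʳ-− u w v (suc s) =
  trans (cong (λ x → (u 0 - w 0) * v (suc s) + x) (⋆-distribʳ-− (tail u) (tail w) v s))
        (regroup (u 0) (w 0) (v (suc s)) _ _)
  where regroup : ∀ a b c x y → (a - b) * c + (x - y) ≡ (a * c + x) - (b * c + y)
        regroup = solve-∀

⋆-scaleʳ : ∀ u x v s → (u ⋆ (λ j → x * v j)) s ≡ x * (u ⋆ v) s
⋆-scaleʳ u x v zero    = regroup (u 0) x (v 0)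
  where regroup : ∀ a x b → a * (x * b) ≡ x * (a * b)
        regroup = solve-∀
⋆-scaleʳ u x v (suc s) =
  trans (cong (λ y → u 0 * (x * v (suc s)) + y) (⋆-scaleʳ (tail u) x v s)) (regroup (u 0) x (v (suc s)) _)
  where regroup : ∀ a x b y → a * (x * b) + x * y ≡ x * (a * b + y)
        regroup = solve-∀

⋆-identityʳ : ∀ u s → (u ⋆ δ) s ≡ u s
⋆-identityʳ u zero    = ℤₚ.*-identityʳ (u 0)
⋆-identityʳ u (suc s) =
  trans (cong (_+ (tail u ⋆ δ) s) (ℤₚ.*-zeroʳ (u 0)))
        (trans (ℤₚ.+-identityˡ ((tail u ⋆ δ) s)) (⋆-identityʳ (tail u) s))

⋆-vanishʳ : ∀ u v s → (∀ j → j ≤ s → v j ≡ + 0) → (u ⋆ v) s ≡ + 0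
⋆-vanishʳ u v zero    v≡0 = trans (cong (u 0 *_) (v≡0 0 z≤n)) (ℤₚ.*-zeroʳ (u 0))
⋆-vanishʳ u v (suc s) v≡0 = cong₂ _+_
  (trans (cong (u 0 *_) (v≡0 (suc s) ℕₚ.≤-refl)) (ℤₚ.*-zeroʳ (u 0)))
  (⋆-vanishʳ (tail u) v s (λ j j≤s → v≡0 j (ℕₚ.m≤n⇒m≤1+n j≤s)))

⋆-head : ∀ u v s → (u ⋆ v) s ≡ u 0 * v s + (shift (tail u) ⋆ v) s
⋆-head u v zero    = sym (ℤₚ.+-identityʳ (u 0 * v 0))
⋆-head u v (suc s) = cong (λ x → u 0 * v (suc s) + x) (sym (ℤₚ.+-identityˡ ((tail u ⋆ v) s)))

⋆-shiftʳ : ∀ u v s → (u ⋆ shift v) s ≡ (shift u ⋆ v) s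
⋆-shiftʳ u v zero    = ℤₚ.*-zeroʳ (u 0)
⋆-shiftʳ u v (suc s) = begin
  u 0 * v s + (tail u ⋆ shift v) s         ≡⟨ cong (λ x → u 0 * v s + x) (⋆-shiftʳ (tail u) v s) ⟩
  u 0 * v s + (shift (tail u) ⋆ v) s       ≡⟨ ⋆-head u v s ⟨
  (u ⋆ v) s                                ≡⟨ ℤₚ.+-identityˡ ((u ⋆ v) s) ⟨
  (shift u ⋆ v) (suc s)                    ∎

⋆-shiftʳ-suc : ∀ u v s → (u ⋆ shift v) (suc s) ≡ (u ⋆ v) s
⋆-shiftʳ-suc u v s = trans (⋆-shiftʳ u v (suc s)) (ℤₚ.+-identityˡ ((u ⋆ v) s))

⋆-Δ : ∀ u v s → (u ⋆ Δ v) s ≡ (Δ u ⋆ v) s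
⋆-Δ u v s = begin
  (u ⋆ Δ v) s                    ≡⟨ ⋆-distribˡ-− u v (shift v) s ⟩
  (u ⋆ v) s - (u ⋆ shift v) s    ≡⟨ cong (λ x → (u ⋆ v) s - x) (⋆-shiftʳ u v s) ⟩
  (u ⋆ v) s - (shift u ⋆ v) s    ≡⟨ ⋆-distribʳ-− u (shift u) v s ⟨
  (Δ u ⋆ v) s                    ∎

⋆-dropʳ : ∀ u v m s → (∀ j → j < m → v j ≡ + 0) → (u ⋆ v) (m ℕ.+ s) ≡ (u ⋆ (λ i → v (m ℕ.+ i))) s
⋆-dropʳ u v zero    s v≡0 = refl
⋆-dropʳ u v (suc m) s v≡0 = begin
  (u ⋆ v) (suc m ℕ.+ s)                 ≡⟨ ⋆-cong {u = u} (λ _ → refl) v≗shift (suc m ℕ.+ s) ⟩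
  (u ⋆ shift (tail v)) (suc (m ℕ.+ s))  ≡⟨ ⋆-shiftʳ-suc u (tail v) (m ℕ.+ s) ⟩
  (u ⋆ tail v) (m ℕ.+ s)                ≡⟨ ⋆-dropʳ u (tail v) m s (λ j j<m → v≡0 (suc j) (s≤s j<m)) ⟩
  (u ⋆ (λ i → v (suc m ℕ.+ i))) s       ∎
  where
  v≗shift : ∀ j → v j ≡ shift (tail v) j
  v≗shift zero    = v≡0 0 (s≤s z≤n)
  v≗shift (suc j) = refl

sumBelow-cong : ∀ n {f g} → (∀ r → r < n → f r ≡ g r) → sumBelow n f ≡ sumBelow n g
sumBelow-cong zero    f≗g = refl
sumBelow-cong (suc n) f≗g =
  cong₂ _+_ (sumBelow-cong n (λ r r<n → f≗g r (ℕₚ.m<n⇒m<1+n r<n))) (f≗g n ℕₚ.≤-refl)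

sumBelow-head : ∀ n f → sumBelow (suc n) f ≡ f 0 + sumBelow n (λ i → f (suc i))
sumBelow-head zero    f = trans (ℤₚ.+-identityˡ (f 0)) (sym (ℤₚ.+-identityʳ (f 0)))
sumBelow-head (suc n) f = trans (cong (_+ f (suc n)) (sumBelow-head n f)) (ℤₚ.+-assoc (f 0) _ _)

⋆≡sumBelow : ∀ u v s → (u ⋆ v) s ≡ sumBelow (suc s) (λ i → u i * v (s ∸ i))
⋆≡sumBelow u v zero    = sym (ℤₚ.+-identityˡ (u 0 * v 0))
⋆≡sumBelow u v (suc s) =
  trans (cong (λ x → u 0 * v (suc s) + x) (⋆≡sumBelow (tail u) v s))
        (sym (sumBelow-head (suc s) (λ i → u i * v (suc s ∸ i))))

-- The coefficients of (1 - x)^n and of (1 - x)^(-(q+1)).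
altBinom : ℕ → Seq
altBinom n j = sgn (+ j) * + (n C j)

negBinom : ℕ → Seq
negBinom q i = + ((q ℕ.+ i) C i)

altBinom-suc : ∀ n j → altBinom (suc n) j ≡ Δ (altBinom n) j
altBinom-suc n zero    = refl
altBinom-suc n (suc j) =
  trans (cong (λ x → sgn (+ suc j) * + x) (sym (nCk+nC[k+1]≡[n+1]C[k+1] n j)))
        (expand (sgn (+ j)) (+ (n C j)) (+ (n C suc j)))
  where expand : ∀ σ x y → (- + 1 * σ) * (x + y) ≡ (- + 1 * σ) * y - σ * x
        expand = solve-∀

Δ-negBinom-suc : ∀ q i → Δ (negBinom (suc q)) i ≡ negBinom q i
Δ-negBinom-suc q zero    = refl
Δ-negBinom-suc q (suc i) = begin
  + ((suc q ℕ.+ suc i) C suc i) - + (n C i)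
    ≡⟨ cong (λ p → + (p C suc i) - + (n C i)) (ℕₚ.+-suc (suc q) i) ⟩
  + (suc n C suc i) - + (n C i)
    ≡⟨ cong (λ x → + x - + (n C i)) (nCk+nC[k+1]≡[n+1]C[k+1] n i) ⟨
  + (n C i) + + (n C suc i) - + (n C i)
    ≡⟨ cancel (+ (n C i)) (+ (n C suc i)) ⟩
  + (n C suc i)
    ≡⟨ cong (λ p → + (p C suc i)) (ℕₚ.+-suc q i) ⟨
  negBinom q (suc i)
    ∎
  where
  n = suc q ℕ.+ i
  cancel : ∀ x y → x + y - x ≡ y
  cancel = solve-∀

Δ-negBinom-zero : ∀ i → Δ (negBinom 0) i ≡ δ i
Δ-negBinom-zero zero    = refl
Δ-negBinom-zero (suc i) rewrite nCn≡1 (suc i) | nCn≡1 i = refl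

altBinom-suc-⋆ : ∀ n w s → (altBinom (suc n) ⋆ w) s ≡ (altBinom n ⋆ Δ w) s
altBinom-suc-⋆ n w s = trans (⋆-cong (altBinom-suc n) (λ _ → refl) s) (sym (⋆-Δ (altBinom n) w s))

altBinom⋆negBinom : ∀ q n s → (altBinom (suc q ℕ.+ n) ⋆ negBinom q) s ≡ altBinom n s
altBinom⋆negBinom zero    n s = begin
  (altBinom (suc n) ⋆ negBinom 0) s                  ≡⟨ altBinom-suc-⋆ n (negBinom 0) s ⟩
  (altBinom n ⋆ Δ (negBinom 0)) s                    ≡⟨ ⋆-cong (λ _ → refl) Δ-negBinom-zero s ⟩
  (altBinom n ⋆ δ) s                                 ≡⟨ ⋆-identityʳ (altBinom n) s ⟩
  altBinom n s                                       ∎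
altBinom⋆negBinom (suc q) n s = begin
  (altBinom (suc (suc q ℕ.+ n)) ⋆ negBinom (suc q)) s ≡⟨ altBinom-suc-⋆ (suc q ℕ.+ n) (negBinom (suc q)) s ⟩
  (altBinom (suc q ℕ.+ n) ⋆ Δ (negBinom (suc q))) s   ≡⟨ ⋆-cong (λ _ → refl) (Δ-negBinom-suc q) s ⟩
  (altBinom (suc q ℕ.+ n) ⋆ negBinom q) s             ≡⟨ altBinom⋆negBinom q n s ⟩
  altBinom n s                                        ∎

-- The closed form of F

F-term : ℕ → ℕ → ℕ → ℤ → ℕ → ℤ
F-term c d k ℓ r = sgn (+ r) * binom (+ c - + 1 - + r) (+ k - + 1 - + r) * binom (+ c + + d - + k) (+ r)
  * binom (+ k - + 1 - + r) (+ k + ℓ - + c - + 1)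

weight : ℕ → ℤ → Seq
weight a ℓ j = + ((a ℕ.+ j) C j) * binom (+ j) (ℓ - + suc a)

F-summand : ∀ r j a b ℓ → let k = suc (r ℕ.+ j) in
  F-term (k ℕ.+ a) (k ℕ.+ b) k ℓ r ≡ altBinom (k ℕ.+ a ℕ.+ b) r * weight a ℓ j
F-summand r j a b ℓ = begin
  sgn (+ r) * binom (+ c - + 1 - + r) (+ k - + 1 - + r) * binom (+ c + + d - + k) (+ r)
    * binom (+ k - + 1 - + r) (+ k + ℓ - + c - + 1)
    ≡⟨ cong₂ (λ x y → sgn (+ r) * binom x y * binom (+ c + + d - + k) (+ r) * binom y (+ k + ℓ - + c - + 1))
             (upper (+ r) (+ j) (+ a)) (lower (+ r) (+ j)) ⟩
  sgn (+ r) * binom (+ (a ℕ.+ j)) (+ j) * binom (+ c + + d - + k) (+ r) * binom (+ j) (+ k + ℓ - + c - + 1)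
    ≡⟨ cong₂ (λ x y → sgn (+ r) * binom (+ (a ℕ.+ j)) (+ j) * binom x (+ r) * binom (+ j) y)
             (total (+ k) (+ a) (+ b)) (offset (+ k) (+ a) ℓ) ⟩
  sgn (+ r) * binom (+ (a ℕ.+ j)) (+ j) * binom (+ (k ℕ.+ a ℕ.+ b)) (+ r) * binom (+ j) (ℓ - + suc a)
    ≡⟨ cong (λ x → sgn (+ r) * x * binom (+ (k ℕ.+ a ℕ.+ b)) (+ r) * binom (+ j) (ℓ - + suc a)) (binom-+ (a ℕ.+ j) j) ⟩
  sgn (+ r) * + ((a ℕ.+ j) C j) * binom (+ (k ℕ.+ a ℕ.+ b)) (+ r) * binom (+ j) (ℓ - + suc a)
    ≡⟨ cong (λ x → sgn (+ r) * + ((a ℕ.+ j) C j) * x * binom (+ j) (ℓ - + suc a)) (binom-+ (k ℕ.+ a ℕ.+ b) r) ⟩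
  sgn (+ r) * + ((a ℕ.+ j) C j) * + ((k ℕ.+ a ℕ.+ b) C r) * binom (+ j) (ℓ - + suc a)
    ≡⟨ regroup (sgn (+ r)) _ _ _ ⟩
  altBinom (k ℕ.+ a ℕ.+ b) r * weight a ℓ j
    ∎
  where
  k = suc (r ℕ.+ j)
  c = k ℕ.+ a
  d = k ℕ.+ b
  upper : ∀ r j a → + 1 + (r + j) + a - + 1 - r ≡ a + j
  upper = solve-∀
  lower : ∀ r j → + 1 + (r + j) - + 1 - r ≡ j
  lower = solve-∀
  total : ∀ k a b → k + a + (k + b) - k ≡ k + a + b
  total = solve-∀
  offset : ∀ k a ℓ → k + ℓ - (k + a) - + 1 ≡ ℓ - (+ 1 + a)
  offset = solve-∀
  regroup : ∀ σ x y z → σ * x * y * z ≡ σ * y * (x * z)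
  regroup = solve-∀

F-as-⋆ : ∀ k′ a b ℓ → let k = suc k′ in
  F (k ℕ.+ a) (k ℕ.+ b) k ℓ ≡ (altBinom (k ℕ.+ a ℕ.+ b) ⋆ weight a ℓ) k′
F-as-⋆ k′ a b ℓ = trans (sumBelow-cong (suc k′) summand) (sym (⋆≡sumBelow _ _ k′))
  where
  summand : ∀ r → r < suc k′ →
    F-term (suc k′ ℕ.+ a) (suc k′ ℕ.+ b) (suc k′) ℓ r ≡ altBinom (suc k′ ℕ.+ a ℕ.+ b) r * weight a ℓ (k′ ∸ r)
  summand r (s≤s r≤k′) with ℕₚ.m≤n⇒∃[o]m+o≡n r≤k′
  ... | j , refl = trans (F-summand r j a b ℓ)
                         (cong (λ i → altBinom (suc (r ℕ.+ j) ℕ.+ a ℕ.+ b) r * weight a ℓ i) (sym (ℕₚ.m+n∸m≡n r j)))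

trinomial : ℕ → ℕ → Seq
trinomial a m j = + (((a ℕ.+ j) C j) ℕ.* (j C m))

F-as-⋆-trinomial : ∀ k′ a b m → let k = suc k′ in
  F (k ℕ.+ a) (k ℕ.+ b) k (+ suc (a ℕ.+ m)) ≡ (altBinom (k ℕ.+ a ℕ.+ b) ⋆ trinomial a m) k′
F-as-⋆-trinomial k′ a b m = trans (F-as-⋆ k′ a b (+ suc (a ℕ.+ m))) (⋆-cong (λ _ → refl) term k′)
  where
  term : ∀ j → weight a (+ suc (a ℕ.+ m)) j ≡ trinomial a m j
  term j = begin
    weight a (+ suc (a ℕ.+ m)) j                   ≡⟨ cong (λ x → + ((a ℕ.+ j) C j) * binom (+ j) x) (cancel (+ a) (+ m)) ⟩
    + ((a ℕ.+ j) C j) * binom (+ j) (+ m)          ≡⟨ cong (+ ((a ℕ.+ j) C j) *_) (binom-+ j m) ⟩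
    + ((a ℕ.+ j) C j) * + (j C m)                  ≡⟨ ℤₚ.pos-* ((a ℕ.+ j) C j) (j C m) ⟨
    trinomial a m j                                ∎
    where cancel : ∀ a m → + 1 + (a + m) - (+ 1 + a) ≡ m
          cancel = solve-∀

trinomial-below : ∀ a m j → j < m → trinomial a m j ≡ + 0
trinomial-below a m j j<m =
  cong +_ (trans (cong (((a ℕ.+ j) C j) ℕ.*_) (k>n⇒nCk≡0 j<m)) (ℕₚ.*-zeroʳ ((a ℕ.+ j) C j)))

trinomial-above : ∀ a m i → trinomial a m (m ℕ.+ i) ≡ + ((a ℕ.+ m) C m) * negBinom (a ℕ.+ m) i
trinomial-above a m i = trans (cong +_ (trinomial-revision a m i)) (ℤₚ.pos-* ((a ℕ.+ m) C m) _)

F-closed-form : ℕ → ℕ → ℕ → ℤ → ℤ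
F-closed-form c d k ℓ = sgn (ℓ - + c) * binom (ℓ - + 1) (+ c - + k) * binom (+ c + + d - + k - ℓ) (+ d - + k)

F-closed-form-ℕ : ∀ k′ a b l → let k = suc k′ in
  F-closed-form (k ℕ.+ a) (k ℕ.+ b) k (+ suc l)
    ≡ sgn (+ l - + (k′ ℕ.+ a)) * + (l C a) * binom (+ (k′ ℕ.+ a ℕ.+ b) - + l) (+ b)
F-closed-form-ℕ k′ a b l = begin
  sgn (ℓ - + c) * binom (ℓ - + 1) (+ c - + k) * binom (+ c + + d - + k - ℓ) (+ d - + k)
    ≡⟨ cong₂ (λ x y → sgn x * binom y (+ c - + k) * binom (+ c + + d - + k - ℓ) (+ d - + k))
             (sign-index (+ k′) (+ a) (+ l)) (top-index (+ l)) ⟩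
  sgn (+ l - + (k′ ℕ.+ a)) * binom (+ l) (+ c - + k) * binom (+ c + + d - + k - ℓ) (+ d - + k)
    ≡⟨ cong₂ (λ x y → sgn (+ l - + (k′ ℕ.+ a)) * binom (+ l) x * binom y (+ d - + k))
             (bottom-index (+ k′) (+ a)) (tail-index (+ k′) (+ a) (+ b) (+ l)) ⟩
  sgn (+ l - + (k′ ℕ.+ a)) * binom (+ l) (+ a) * binom (+ (k′ ℕ.+ a ℕ.+ b) - + l) (+ d - + k)
    ≡⟨ cong₂ (λ x y → sgn (+ l - + (k′ ℕ.+ a)) * x * binom (+ (k′ ℕ.+ a ℕ.+ b) - + l) y)
             (binom-+ l a) (bottom-index (+ k′) (+ b)) ⟩
  sgn (+ l - + (k′ ℕ.+ a)) * + (l C a) * binom (+ (k′ ℕ.+ a ℕ.+ b) - + l) (+ b)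
    ∎
  where
  k = suc k′
  c = k ℕ.+ a
  d = k ℕ.+ b
  ℓ = + suc l
  sign-index : ∀ k′ a l → + 1 + l - (+ 1 + k′ + a) ≡ l - (k′ + a)
  sign-index = solve-∀
  top-index : ∀ l → + 1 + l - + 1 ≡ l
  top-index = solve-∀
  bottom-index : ∀ k′ a → + 1 + k′ + a - (+ 1 + k′) ≡ a
  bottom-index = solve-∀
  tail-index : ∀ k′ a b l → + 1 + k′ + a + (+ 1 + k′ + b) - (+ 1 + k′) - (+ 1 + l) ≡ k′ + a + b - l
  tail-index = solve-∀

F-closed-below : ∀ k′ l t b → let k = suc k′ ; a = suc (l ℕ.+ t) in
  F (k ℕ.+ a) (k ℕ.+ b) k (+ suc l) ≡ F-closed-form (k ℕ.+ a) (k ℕ.+ b) k (+ suc l)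
F-closed-below k′ l t b = begin
  F (k ℕ.+ a) (k ℕ.+ b) k (+ suc l)                    ≡⟨ F-as-⋆ k′ a b (+ suc l) ⟩
  (altBinom (k ℕ.+ a ℕ.+ b) ⋆ weight a (+ suc l)) k′
                                                       ≡⟨ ⋆-vanishʳ _ (weight a (+ suc l)) k′ (λ j _ → weight≡0 j) ⟩
  + 0                                                  ≡⟨ vanish (sgn (+ l - + (k′ ℕ.+ a))) _ ⟨
  sgn (+ l - + (k′ ℕ.+ a)) * + 0 * binom (+ (k′ ℕ.+ a ℕ.+ b) - + l) (+ b)
    ≡⟨ cong (λ x → sgn (+ l - + (k′ ℕ.+ a)) * + x * binom (+ (k′ ℕ.+ a ℕ.+ b) - + l) (+ b))
            (k>n⇒nCk≡0 (s≤s (ℕₚ.m≤m+n l t))) ⟨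
  sgn (+ l - + (k′ ℕ.+ a)) * + (l C a) * binom (+ (k′ ℕ.+ a ℕ.+ b) - + l) (+ b)
    ≡⟨ F-closed-form-ℕ k′ a b l ⟨
  F-closed-form (k ℕ.+ a) (k ℕ.+ b) k (+ suc l)        ∎
  where
  k = suc k′
  a = suc (l ℕ.+ t)
  negative : ∀ l t → + 1 + l - (+ 1 + (+ 1 + (l + t))) ≡ - (+ 1 + t)
  negative = solve-∀
  weight≡0 : ∀ j → weight a (+ suc l) j ≡ + 0
  weight≡0 j = trans (cong (λ x → + ((a ℕ.+ j) C j) * binom (+ j) x) (negative (+ l) (+ t)))
                     (ℤₚ.*-zeroʳ (+ ((a ℕ.+ j) C j)))
  vanish : ∀ σ y → σ * + 0 * y ≡ + 0
  vanish = solve-∀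

F-closed-middle : ∀ a b m s → let k = suc (m ℕ.+ s) in
  F (k ℕ.+ a) (k ℕ.+ b) k (+ suc (a ℕ.+ m)) ≡ F-closed-form (k ℕ.+ a) (k ℕ.+ b) k (+ suc (a ℕ.+ m))
F-closed-middle a b m s = begin
  F (k ℕ.+ a) (k ℕ.+ b) k (+ suc (a ℕ.+ m))
    ≡⟨ F-as-⋆-trinomial (m ℕ.+ s) a b m ⟩
  (altBinom N ⋆ trinomial a m) (m ℕ.+ s)
    ≡⟨ ⋆-dropʳ (altBinom N) (trinomial a m) m s (trinomial-below a m) ⟩
  (altBinom N ⋆ (λ i → trinomial a m (m ℕ.+ i))) s
    ≡⟨ ⋆-cong (λ _ → refl) (trinomial-above a m) s ⟩
  (altBinom N ⋆ (λ i → X * negBinom (a ℕ.+ m) i)) s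
    ≡⟨ ⋆-scaleʳ (altBinom N) X (negBinom (a ℕ.+ m)) s ⟩
  X * (altBinom N ⋆ negBinom (a ℕ.+ m)) s
    ≡⟨ cong (λ n → X * (altBinom n ⋆ negBinom (a ℕ.+ m)) s) (reorder m s a b) ⟩
  X * (altBinom (suc (a ℕ.+ m) ℕ.+ (b ℕ.+ s)) ⋆ negBinom (a ℕ.+ m)) s
    ≡⟨ cong (X *_) (altBinom⋆negBinom (a ℕ.+ m) (b ℕ.+ s) s) ⟩
  X * (sgn (+ s) * + ((b ℕ.+ s) C s))
    ≡⟨ regroup (sgn (+ s)) X (+ ((b ℕ.+ s) C s)) ⟩
  sgn (+ s) * X * + ((b ℕ.+ s) C s)
    ≡⟨ cong₂ (λ σ x → σ * + x * + ((b ℕ.+ s) C s)) (sgn-neg (+ s)) ([m+n]Cm≡[m+n]Cn a m) ⟨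
  sgn (- + s) * + ((a ℕ.+ m) C a) * + ((b ℕ.+ s) C s)
    ≡⟨ cong (λ x → sgn (- + s) * + ((a ℕ.+ m) C a) * x)
            (trans (binom-+ (b ℕ.+ s) b) (cong +_ ([m+n]Cm≡[m+n]Cn b s))) ⟨
  sgn (- + s) * + ((a ℕ.+ m) C a) * binom (+ (b ℕ.+ s)) (+ b)
    ≡⟨ cong₂ (λ x y → sgn x * + ((a ℕ.+ m) C a) * binom y (+ b))
             (sign-index (+ a) (+ m) (+ s)) (tail-index (+ a) (+ b) (+ m) (+ s)) ⟨
  sgn (+ (a ℕ.+ m) - + (m ℕ.+ s ℕ.+ a)) * + ((a ℕ.+ m) C a) * binom (+ (m ℕ.+ s ℕ.+ a ℕ.+ b) - + (a ℕ.+ m)) (+ b)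
    ≡⟨ F-closed-form-ℕ (m ℕ.+ s) a b (a ℕ.+ m) ⟨
  F-closed-form (k ℕ.+ a) (k ℕ.+ b) k (+ suc (a ℕ.+ m))
    ∎
  where
  k = suc (m ℕ.+ s)
  N = k ℕ.+ a ℕ.+ b
  X = + ((a ℕ.+ m) C m)
  reorder : ∀ m s a b → suc (m ℕ.+ s) ℕ.+ a ℕ.+ b ≡ suc (a ℕ.+ m) ℕ.+ (b ℕ.+ s)
  reorder = ℕ-solve-∀
  regroup : ∀ σ x y → x * (σ * y) ≡ σ * x * y
  regroup = solve-∀
  sign-index : ∀ a m s → a + m - (m + s + a) ≡ - s
  sign-index = solve-∀
  tail-index : ∀ a b m s → m + s + a + b - (a + m) ≡ b + s
  tail-index = solve-∀

F-closed-above : ∀ k′ a e f → let k = suc k′ ; m = suc (k′ ℕ.+ e) ; b = suc (e ℕ.+ f) in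
  F (k ℕ.+ a) (k ℕ.+ b) k (+ suc (a ℕ.+ m)) ≡ F-closed-form (k ℕ.+ a) (k ℕ.+ b) k (+ suc (a ℕ.+ m))
F-closed-above k′ a e f = begin
  F (k ℕ.+ a) (k ℕ.+ b) k (+ suc l)
    ≡⟨ F-as-⋆-trinomial k′ a b m ⟩
  (altBinom (k ℕ.+ a ℕ.+ b) ⋆ trinomial a m) k′
    ≡⟨ ⋆-vanishʳ _ (trinomial a m) k′ (λ j j≤k′ → trinomial-below a m j (s≤s (ℕₚ.≤-trans j≤k′ (ℕₚ.m≤m+n k′ e)))) ⟩
  + 0
    ≡⟨ ℤₚ.*-zeroʳ (sgn σ * + (l C a)) ⟨
  sgn σ * + (l C a) * + 0
    ≡⟨ cong (λ x → sgn σ * + (l C a) * + x) (k>n⇒nCk≡0 (s≤s (ℕₚ.m≤n+m f e))) ⟨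
  sgn σ * + (l C a) * + (f C b)
    ≡⟨ cong (λ x → sgn σ * + (l C a) * x) (trans (cong (λ x → binom x (+ b)) tail-index) (binom-+ f b)) ⟨
  sgn σ * + (l C a) * binom (+ (k′ ℕ.+ a ℕ.+ b) - + l) (+ b)
    ≡⟨ F-closed-form-ℕ k′ a b l ⟨
  F-closed-form (k ℕ.+ a) (k ℕ.+ b) k (+ suc l)
    ∎
  where
  k = suc k′
  m = suc (k′ ℕ.+ e)
  b = suc (e ℕ.+ f)
  l = a ℕ.+ m
  σ = + l - + (k′ ℕ.+ a)
  tail-index : + (k′ ℕ.+ a ℕ.+ b) - + l ≡ + f
  tail-index = cancel (+ k′) (+ a) (+ e) (+ f)
    where cancel : ∀ k′ a e f → k′ + a + (+ 1 + (e + f)) - (a + (+ 1 + (k′ + e))) ≡ f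
          cancel = solve-∀

suc[e]≤b : ∀ k′ a b e → a ℕ.+ suc (k′ ℕ.+ e) ≤ k′ ℕ.+ a ℕ.+ b → suc e ≤ b
suc[e]≤b k′ a b e = ℕₚ.+-cancelˡ-≤ (k′ ℕ.+ a) (suc e) b ∘ subst (ℕ._≤ k′ ℕ.+ a ℕ.+ b) (reorder k′ a e)
  where
  reorder : ∀ k′ a e → a ℕ.+ suc (k′ ℕ.+ e) ≡ k′ ℕ.+ a ℕ.+ suc e
  reorder = ℕ-solve-∀

F-closed : ∀ k′ a b l → l ≤ k′ ℕ.+ a ℕ.+ b → let k = suc k′ in
  F (k ℕ.+ a) (k ℕ.+ b) k (+ suc l) ≡ F-closed-form (k ℕ.+ a) (k ℕ.+ b) k (+ suc l)
F-closed k′ a b l l≤ with ℕₚ.<-≤-connex l a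
... | inj₁ l<a with ℕₚ.m≤n⇒∃[o]m+o≡n l<a
...   | t , refl = F-closed-below k′ l t b
F-closed k′ a b l l≤ | inj₂ a≤l with ℕₚ.m≤n⇒∃[o]m+o≡n a≤l
... | m , refl with ℕₚ.≤-<-connex m k′
...   | inj₁ m≤k′ with ℕₚ.m≤n⇒∃[o]m+o≡n m≤k′
...     | s , refl = F-closed-middle a b m s
F-closed k′ a b .(a ℕ.+ m) l≤ | inj₂ _ | m , refl | inj₂ k′<m with ℕₚ.m≤n⇒∃[o]m+o≡n k′<m
...     | e , refl with ℕₚ.m≤n⇒∃[o]m+o≡n (suc[e]≤b k′ a b e l≤)
...       | f , refl = F-closed-above k′ a e f

-- The closed form of G and the relation between F and G

G≡F-reflected : ∀ c d k ℓ → G c d k ℓ ≡ F d c k (+ c + + d - + k + + 1 - ℓ)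
G≡F-reflected c d k ℓ = sumBelow-cong k λ r _ →
  cong₂ (λ x y → sgn (+ r) * binom (+ d - + 1 - + r) (+ k - + 1 - + r) * binom x (+ r) * binom (+ k - + 1 - + r) y)
        (comm (+ c) (+ d) (+ k)) (reflect (+ c) (+ d) (+ k) ℓ)
  where
  comm : ∀ c d k → c + d - k ≡ d + c - k
  comm = solve-∀
  reflect : ∀ c d k ℓ → c - ℓ ≡ k + (c + d - k + + 1 - ℓ) - d - + 1
  reflect = solve-∀

G-closed-form : ℕ → ℕ → ℕ → ℤ → ℤ
G-closed-form c d k ℓ =
  sgn (ℓ + + k - + c - + 1) * binom (ℓ - + 1) (+ c - + k) * binom (+ c + + d - + k - ℓ) (+ d - + k)

F-closed-form-reflected : ∀ c d k ℓ → F-closed-form d c k (+ c + + d - + k + + 1 - ℓ) ≡ G-closed-form c d k ℓ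
F-closed-form-reflected c d k ℓ = begin
  sgn (ℓ′ - + d) * binom (ℓ′ - + 1) (+ d - + k) * binom (+ d + + c - + k - ℓ′) (+ c - + k)
    ≡⟨ cong₂ (λ y z → sgn (ℓ′ - + d) * binom y (+ d - + k) * binom z (+ c - + k))
             (top-index (+ c) (+ d) (+ k) ℓ) (tail-index (+ c) (+ d) (+ k) ℓ) ⟩
  sgn (ℓ′ - + d) * B₂ * B₁
    ≡⟨ cong (λ x → sgn x * B₂ * B₁) (sign-index (+ c) (+ d) (+ k) ℓ) ⟩
  sgn (- (ℓ + + k - + c - + 1)) * B₂ * B₁
    ≡⟨ cong (λ σ → σ * B₂ * B₁) (sgn-neg (ℓ + + k - + c - + 1)) ⟩
  sgn (ℓ + + k - + c - + 1) * B₂ * B₁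
    ≡⟨ swap (sgn (ℓ + + k - + c - + 1)) B₂ B₁ ⟩
  G-closed-form c d k ℓ
    ∎
  where
  ℓ′ = + c + + d - + k + + 1 - ℓ
  B₁ = binom (ℓ - + 1) (+ c - + k)
  B₂ = binom (+ c + + d - + k - ℓ) (+ d - + k)
  sign-index : ∀ c d k ℓ → c + d - k + + 1 - ℓ - d ≡ - (ℓ + k - c - + 1)
  sign-index = solve-∀
  top-index : ∀ c d k ℓ → c + d - k + + 1 - ℓ - + 1 ≡ c + d - k - ℓ
  top-index = solve-∀
  tail-index : ∀ c d k ℓ → d + c - k - (c + d - k + + 1 - ℓ) ≡ ℓ - + 1
  tail-index = solve-∀
  swap : ∀ σ x y → σ * x * y ≡ σ * y * x
  swap = solve-∀

G-closed : ∀ k′ a b l → l ≤ k′ ℕ.+ a ℕ.+ b → let k = suc k′ in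
  G (k ℕ.+ a) (k ℕ.+ b) k (+ suc l) ≡ G-closed-form (k ℕ.+ a) (k ℕ.+ b) k (+ suc l)
G-closed k′ a b l l≤ with ℕₚ.m≤n⇒∃[o]m+o≡n l≤
... | l′ , l+l′≡ = begin
  G c d k ℓ                        ≡⟨ G≡F-reflected c d k ℓ ⟩
  F d c k ℓ′                       ≡⟨ cong (F d c k) ℓ′≡ ⟩
  F d c k (+ suc l′)               ≡⟨ F-closed k′ b a l′ l′≤ ⟩
  F-closed-form d c k (+ suc l′)   ≡⟨ cong (F-closed-form d c k) ℓ′≡ ⟨
  F-closed-form d c k ℓ′           ≡⟨ F-closed-form-reflected c d k ℓ ⟩
  G-closed-form c d k ℓ            ∎
  where
  k = suc k′
  c = k ℕ.+ a
  d = k ℕ.+ b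
  ℓ = + suc l
  ℓ′ = + c + + d - + k + + 1 - ℓ
  reflect : ∀ k′ a b l → + 1 + k′ + a + (+ 1 + k′ + b) - (+ 1 + k′) + + 1 - (+ 1 + l) ≡ + 1 + (k′ + a + b) - l
  reflect = solve-∀
  cancel : ∀ l l′ → + 1 + (l + l′) - l ≡ + 1 + l′
  cancel = solve-∀
  ℓ′≡ : ℓ′ ≡ + suc l′
  ℓ′≡ = trans (reflect (+ k′) (+ a) (+ b) (+ l))
              (trans (cong (λ x → + 1 + + x - + l) (sym l+l′≡)) (cancel (+ l) (+ l′)))
  swap-ab : ∀ k′ a b → k′ ℕ.+ a ℕ.+ b ≡ k′ ℕ.+ b ℕ.+ a
  swap-ab = ℕ-solve-∀
  l′≤ : l′ ≤ k′ ℕ.+ b ℕ.+ a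
  l′≤ = subst (l′ ≤_) (trans l+l′≡ (swap-ab k′ a b)) (ℕₚ.m≤n+m l′ l)

closed-forms-cancel : ∀ c k′ ℓ x y →
  sgn (ℓ - + c) * x * y + sgn (+ suc k′) * (sgn (ℓ + + suc k′ - + c - + 1) * x * y) ≡ + 0
closed-forms-cancel c k′ ℓ x y = begin
  σ * x * y + sgn (+ suc k′) * (sgn (ℓ + + suc k′ - + c - + 1) * x * y)
    ≡⟨ cong (λ e → σ * x * y + sgn (+ suc k′) * (sgn e * x * y)) (exponent ℓ (+ c) (+ k′)) ⟩
  σ * x * y + sgn (+ suc k′) * (sgn (ℓ - + c + + k′) * x * y)
    ≡⟨ cong (λ τ → σ * x * y + sgn (+ suc k′) * (τ * x * y)) (sgn-+ (ℓ - + c) k′) ⟩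
  σ * x * y + (- + 1 * τ) * (σ * τ * x * y)
    ≡⟨ factor σ τ x y ⟩
  σ * x * y * (+ 1 - τ * τ)
    ≡⟨ cong (λ t → σ * x * y * (+ 1 - t)) (sgn[n]*sgn[n]≡1 k′) ⟩
  σ * x * y * (+ 1 - + 1)
    ≡⟨ ℤₚ.*-zeroʳ (σ * x * y) ⟩
  + 0 ∎
  where
  σ = sgn (ℓ - + c)
  τ = sgn (+ k′)
  exponent : ∀ ℓ c k′ → ℓ + (+ 1 + k′) - c - + 1 ≡ ℓ - c + k′
  exponent = solve-∀
  factor : ∀ σ τ x y → σ * x * y + (- + 1 * τ) * (σ * τ * x * y) ≡ σ * x * y * (+ 1 - τ * τ)
  factor = solve-∀

lemma7 : (c d k : ℕ) → 1 ≤ k → k ≤ c → c ≤ d →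
    (ℓ : ℤ) → + 1 ≤ℤ ℓ → ℓ ≤ℤ + c + + d - + k →
    (F c d k ℓ ≡ sgn (ℓ - + c) * binom (ℓ - + 1) (+ c - + k) * binom (+ c + + d - + k - ℓ) (+ d - + k))
    × (G c d k ℓ ≡ sgn (ℓ + + k - + c - + 1) * binom (ℓ - + 1) (+ c - + k) * binom (+ c + + d - + k - ℓ) (+ d - + k))
    × (F c d k ℓ + sgn (+ k) * G c d k ℓ ≡ + 0)
lemma7 c d (suc k′) _ k≤c c≤d (+ suc l) _ ℓ≤
  with ℕₚ.m≤n⇒∃[o]m+o≡n k≤c | ℕₚ.m≤n⇒∃[o]m+o≡n (ℕₚ.≤-trans k≤c c≤d)
... | a , refl | b , refl =
  F≡ , G≡ , trans (cong₂ (λ x y → x + sgn (+ suc k′) * y) F≡ G≡) (closed-forms-cancel c′ k′ ℓ _ _)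
  where
  c′ = suc k′ ℕ.+ a
  d′ = suc k′ ℕ.+ b
  ℓ = + suc l
  range : ∀ k′ a b → + 1 + k′ + a + (+ 1 + k′ + b) - (+ 1 + k′) ≡ + 1 + (k′ + a + b)
  range = solve-∀
  l≤ : l ≤ k′ ℕ.+ a ℕ.+ b
  l≤ = ℕₚ.≤-pred (ℤₚ.drop‿+≤+ (subst (ℓ ≤ℤ_) (range (+ k′) (+ a) (+ b)) ℓ≤))
  F≡ : F c′ d′ (suc k′) ℓ ≡ F-closed-form c′ d′ (suc k′) ℓ
  F≡ = F-closed k′ a b l l≤
  G≡ : G c′ d′ (suc k′) ℓ ≡ G-closed-form c′ d′ (suc k′) ℓ
  G≡ = G-closed k′ a b l l≤
lemma7 c d k _ _ _ (+ zero) (ℤ.+≤+ ()) _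
lemma7 c d k _ _ _ -[1+ _ ] () _
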